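{- Let $n\ge1$, $q$ a prime power with $n\mid q-1$, $\delta$ a generator of $\mathrm{Hom}(\mathbb{F}_q^\times,\mathbb{C}^\times)$ and $\zeta_n\in\mathbb{F}_q^\times$ of order $n$. Let $d,\widehat d,t,\widehat t$ be positive integers with $t\mid q-1$, $d\widehat t=\widehat d t$, put $s=(q-1)/t$, and let $\lambda_1,\dots,\lambda_m$ be positive integers. Then $\delta(\zeta_n)^{ds\binom{\widehat t}{2}\sum_i\lambda_i}=\pm1$, and if moreover $q\equiv1\pmod n$ for $n$ odd, resp. $q\equiv1\pmod{2n}$ for $n$ even, then it equals $1$. -}

module Defs where

open import Level using (Level; _⊔_)
open import Data.Nat as ℕ using (ℕ; zero; suc)
open import Data.Fin using (Fin)
open import Data.List using (List; []; _∷_)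
open import Data.Product using (Σ; ∃; ∃-syntax; _×_)
open import Data.Nat.Primality using (Prime)
open import Relation.Nullary using (¬_)
open import Relation.Binary.PropositionalEquality using (_≡_; _≢_)
open import Algebra.Bundles using (CommutativeRing)

IsPrimePower : ℕ → Set
IsPrimePower q = ∃[ p ] ∃[ e ] (Prime p × q ≡ p ℕ.^ suc e)

record Field (c ℓ : Level) : Set (Level.suc (c ⊔ ℓ)) where
  field
    commutativeRing : CommutativeRing c ℓ
  open CommutativeRing commutativeRing public
  field
    0≉1 : ¬ (0# ≈ 1#)
    inverse : ∀ x → ¬ (x ≈ 0#) → ∃[ y ] (x * y ≈ 1#)

  pow : Carrier → ℕ → Carrier
  pow x zero = 1#
  pow x (suc k) = x * pow x k

  fromℕ : ℕ → Carrier
  fromℕ zero = 0#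
  fromℕ (suc n) = 1# + fromℕ n

  -- evaluation of the MONIC polynomial
  --   a₀ + a₁ x + ... + a_{k-1} x^{k-1} + x^k   given by [a₀, ..., a_{k-1}]
  evalMonic : List Carrier → Carrier → Carrier
  evalMonic [] x = 1#
  evalMonic (a ∷ as) x = a + x * evalMonic as x

  HasOrder : Carrier → ℕ → Set ℓ
  HasOrder x n =
    ¬ (x ≈ 0#) × (pow x n ≈ 1#) × (∀ m → 0 ℕ.< m → m ℕ.< n → ¬ (pow x m ≈ 1#))

open Field

HasCardinality : ∀ {c ℓ} → Field c ℓ → ℕ → Set (c ⊔ ℓ)
HasCardinality F q =
  Σ (Fin q → Carrier F) λ enum →
    (∀ i j → _≈_ F (enum i) (enum j) → i ≡ j) ×
    (∀ x → ∃[ i ] (_≈_ F (enum i) x))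

CharZero : ∀ {c ℓ} → Field c ℓ → Set ℓ
CharZero K = ∀ n → ¬ (_≈_ K (fromℕ K (suc n)) (0# K))

AlgClosed : ∀ {c ℓ} → Field c ℓ → Set (c ⊔ ℓ)
AlgClosed K = ∀ (as : List (Carrier K)) → as ≢ [] →
  ∃[ x ] (_≈_ K (evalMonic K as x) (0# K))

-- group homomorphisms F^× → K^× (given by a function on F that is only
-- constrained on nonzero elements)
record UnitHom {c ℓ c' ℓ'} (F : Field c ℓ) (K : Field c' ℓ') : Set (c ⊔ ℓ ⊔ c' ⊔ ℓ') where
  field
    map : Carrier F → Carrier K
    map-cong : ∀ {x y} → ¬ (_≈_ F x (0# F)) → _≈_ F x y → _≈_ K (map x) (map y)
    map-unit : ∀ x → ¬ (_≈_ F x (0# F)) → ¬ (_≈_ K (map x) (0# K))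
    map-hom : ∀ x y → ¬ (_≈_ F x (0# F)) → ¬ (_≈_ F y (0# F)) →
      _≈_ K (map (_*_ F x y)) (_*_ K (map x) (map y))
open UnitHom public

IsGenerator : ∀ {c ℓ c' ℓ'} {F : Field c ℓ} {K : Field c' ℓ'} → UnitHom F K → Set (c ⊔ ℓ ⊔ c' ⊔ ℓ')
IsGenerator {F = F} {K = K} δ = ∀ (χ : UnitHom F K) → ∃[ k ] ∀ x → ¬ (_≈_ F x (0# F)) →
  _≈_ K (map χ x) (pow K (map δ x) k)

module Submission where

-- Lemma 6.1.  Put E = d s C(t̂,2) Σλᵢ and ω = δ(ζ).  Since d t̂ = d̂ t and s t = q - 1,
-- 2E = d̂ (q - 1)(t̂ - 1) Σλᵢ is a multiple of n, so (ζ^E)² = 1 and ζ^E = ±1 in F.  A character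
-- sends 1 to 1, and the substance of the proof is that a generator δ of Hom(F^×, K^×) sends
-- -1 to -1 whenever -1 ≠ 1 in F: it suffices to exhibit one character χ with χ(-1) = -1, as
-- χ is a power of δ.  We build χ on the 2-primary part of F^×, which is cyclic with a
-- generator g satisfying g^(2^b) = -1, by sending g to a root ξ of X^(2^b) + 1 in the
-- algebraically closed field K.  Under the congruence hypothesis n even ⇒ 2n ∣ q - 1 we even
-- get n ∣ E, hence ω^E = 1.

open import Defs

open import Level using (0ℓ; _⊔_)
open import Data.Nat as ℕ using (ℕ; zero; suc; _<_; _≤_; z≤n; s≤s; NonZero; _!)
import Data.Nat.Properties as ℕP
open import Data.Nat.Divisibility using (_∣_; divides; *-monoʳ-∣; ∣m⇒∣m*n; ∣n⇒∣m*n)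
open import Data.Nat.DivMod using (m/n*n≡m)
open import Data.Nat.Combinatorics using (_C_)
open import Data.Nat.ListAction using (sum)
open import Data.Fin as Fin using (Fin; toℕ)
import Data.Fin.Properties as FinP
open import Data.List using (List; _∷_; replicate)
open import Data.List.Relation.Unary.All using (All)
open import Data.Product using (∃-syntax; _×_; _,_; proj₁; proj₂)
open import Data.Sum as Sum using (_⊎_; inj₁; inj₂)
open import Function using (_∘_)
open import Relation.Nullary using (¬_; Dec; yes; no; contradiction)
open import Relation.Nullary.Decidable using (¬?; _→-dec_; map′)
open import Relation.Binary.Definitions using (_Respects_)
open import Relation.Binary.PropositionalEquality as ≡ using (_≡_)

module Arithmetic where
  open import Data.Nat using (_+_; _*_; _^_; _∸_)
  open ℕP
  open import Data.Nat.Divisibility using (_∣?_; ∣⇒≤; 0∣⇒≡0; *-cancelˡ-∣)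
  open import Data.Nat.Combinatorics using (nC1≡n; nCk+nC[k+1]≡[n+1]C[k+1])
  open import Data.Nat.Coprimality using (Coprime; coprime-divisor)
  open import Data.Nat.Induction using (<-rec)
  open import Data.Nat.Tactic.RingSolver using (solve-∀)
  open ≡ using (refl; cong; sym; trans)
  open ≡.≡-Reasoning

  parity : ∀ m → ∃[ k ] (m ≡ 2 * k ⊎ m ≡ suc (2 * k))
  parity zero = 0 , inj₁ refl
  parity (suc m) with parity m
  ... | k , inj₁ m≡2k = k , inj₂ (cong suc m≡2k)
  ... | k , inj₂ m≡2k+1 = suc k , inj₁ (cong suc (trans m≡2k+1 (sym (+-suc k (k + 0)))))

  OddPart : ℕ → Set
  OddPart N = ∃[ a ] ∃[ v ] (N ≡ 2 ^ a * suc (2 * v))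

  two-adic : ∀ N → 0 < N → OddPart N
  two-adic = <-rec (λ N → 0 < N → OddPart N) factor
    where
    factor : ∀ N → (∀ {M} → M < N → 0 < M → OddPart M) → 0 < N → OddPart N
    factor N rec N>0 with parity N
    ... | v , inj₂ N≡2v+1 = 0 , v , trans N≡2v+1 (sym (+-identityʳ _))
    ... | zero , inj₁ refl = contradiction N>0 λ ()
    ... | suc k , inj₁ refl with rec (m<m+n (suc k) (s≤s z≤n)) (s≤s z≤n)
    ...   | a , v , k+1≡2^a*u = suc a , v , trans (cong (2 *_) k+1≡2^a*u) (sym (*-assoc 2 (2 ^ a) _))

  switch-point : ∀ {p} {P : ℕ → Set p} → (∀ b → Dec (P b)) → ¬ P 0 →
                 ∀ a → P a → ∃[ b ] (P (suc b) × ¬ P b)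
  switch-point P? ¬P0 zero P0 = contradiction P0 ¬P0
  switch-point P? ¬P0 (suc a) Pa+1 with P? a
  ... | yes Pa = switch-point P? ¬P0 a Pa
  ... | no ¬Pa = a , Pa+1 , ¬Pa

  double-choose-2 : ∀ k → 2 * (k C 2) ≡ k * (k ∸ 1)
  double-choose-2 zero = refl
  double-choose-2 (suc zero) = refl
  double-choose-2 (suc (suc p)) = begin
    2 * (suc (suc p) C 2)             ≡⟨ cong (2 *_) (sym (nCk+nC[k+1]≡[n+1]C[k+1] (suc p) 1)) ⟩
    2 * (suc p C 1 + suc p C 2)       ≡⟨ *-distribˡ-+ 2 (suc p C 1) (suc p C 2) ⟩
    2 * (suc p C 1) + 2 * (suc p C 2) ≡⟨ ≡.cong₂ _+_ (cong (2 *_) (nC1≡n (suc p))) (double-choose-2 (suc p)) ⟩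
    2 * suc p + suc p * p             ≡⟨ pascal-step p ⟩
    suc (suc p) * suc p               ∎
    where
    pascal-step : ∀ p → 2 * suc p + suc p * p ≡ suc (suc p) * suc p
    pascal-step = solve-∀

  twice-exponent : ∀ d d̂ t t̂ s S → d * t̂ ≡ d̂ * t →
                   2 * (d * s * (t̂ C 2) * S) ≡ d̂ * (s * t) * ((t̂ ∸ 1) * S)
  twice-exponent d d̂ t t̂ s S dt̂≡d̂t = begin
    2 * (d * s * (t̂ C 2) * S)       ≡⟨ regroup₁ d s (t̂ C 2) S ⟩
    d * s * (2 * (t̂ C 2)) * S       ≡⟨ cong (λ z → d * s * z * S) (double-choose-2 t̂) ⟩
    d * s * (t̂ * (t̂ ∸ 1)) * S       ≡⟨ regroup₂ d s t̂ (t̂ ∸ 1) S ⟩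
    d * t̂ * (s * ((t̂ ∸ 1) * S))     ≡⟨ cong (_* (s * ((t̂ ∸ 1) * S))) dt̂≡d̂t ⟩
    d̂ * t * (s * ((t̂ ∸ 1) * S))     ≡⟨ regroup₃ d̂ t s (t̂ ∸ 1) S ⟩
    d̂ * (s * t) * ((t̂ ∸ 1) * S)     ∎
    where
    regroup₁ : ∀ d s c S → 2 * (d * s * c * S) ≡ d * s * (2 * c) * S
    regroup₁ = solve-∀
    regroup₂ : ∀ d s t̂ r S → d * s * (t̂ * r) * S ≡ d * t̂ * (s * (r * S))
    regroup₂ = solve-∀
    regroup₃ : ∀ d̂ t s r S → d̂ * t * (s * (r * S)) ≡ d̂ * (s * t) * (r * S)
    regroup₃ = solve-∀

  odd⇒coprime-2 : ∀ {n} → ¬ 2 ∣ n → Coprime n 2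
  odd⇒coprime-2 2∤n {zero} (_ , 0∣2) with 0∣⇒≡0 0∣2
  ... | ()
  odd⇒coprime-2 2∤n {suc zero} _ = refl
  odd⇒coprime-2 2∤n {suc (suc zero)} (2∣n , _) = contradiction 2∣n 2∤n
  odd⇒coprime-2 2∤n {suc (suc (suc i))} (_ , i+3∣2) with ∣⇒≤ i+3∣2
  ... | s≤s (s≤s ())

  divides-half : ∀ {n E} → n ∣ 2 * E → (2 ∣ n → 2 * n ∣ 2 * E) → n ∣ E
  divides-half {n} n∣2E even with 2 ∣? n
  ... | yes 2∣n = *-cancelˡ-∣ 2 (even 2∣n)
  ... | no 2∤n = coprime-divisor (odd⇒coprime-2 2∤n) n∣2E

module FieldPowers {c ℓ} (F : Field c ℓ) where
  open Field F
  open import Algebra.Properties.CommutativeSemiring.Exp commutativeSemiring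
    using (_^_; ^-congˡ; ^-homo-*; ^-assocʳ; ^-distrib-*)
  open import Algebra.Properties.Ring ring using (-1*x≈-x; [y-z]x≈yx-zx)
  open import Algebra.Properties.Group +-group
    using (⁻¹-involutive; ε⁻¹≈ε; inverseˡ-unique; inverseʳ-unique; x∙y⁻¹≈ε⇒x≈y)
  open import Relation.Binary.Reasoning.Setoid setoid

  -- Field.pow is the library's exponentiation, so the library's power laws apply to it
  pow≡^ : ∀ x k → pow x k ≡ x ^ k
  pow≡^ x zero = ≡.refl
  pow≡^ x (suc k) = ≡.cong (x *_) (pow≡^ x k)

  pow-≡ : ∀ x {a b} → a ≡ b → pow x a ≈ pow x b
  pow-≡ x a≡b = reflexive (≡.cong (pow x) a≡b)

  pow-cong : ∀ {x y} k → x ≈ y → pow x k ≈ pow y k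
  pow-cong {x} {y} k x≈y rewrite pow≡^ x k | pow≡^ y k = ^-congˡ k x≈y

  pow-+ : ∀ x a b → pow x (a ℕ.+ b) ≈ pow x a * pow x b
  pow-+ x a b rewrite pow≡^ x (a ℕ.+ b) | pow≡^ x a | pow≡^ x b = ^-homo-* x a b

  pow-* : ∀ x a b → pow x (a ℕ.* b) ≈ pow (pow x a) b
  pow-* x a b rewrite pow≡^ (pow x a) b | pow≡^ x a | pow≡^ x (a ℕ.* b) = sym (^-assocʳ x a b)

  pow-distrib : ∀ x y k → pow (x * y) k ≈ pow x k * pow y k
  pow-distrib x y k rewrite pow≡^ (x * y) k | pow≡^ x k | pow≡^ y k = ^-distrib-* x y k

  pow-1# : ∀ k → pow 1# k ≈ 1#
  pow-1# zero = refl
  pow-1# (suc k) = trans (*-identityˡ _) (pow-1# k)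

  pow-dvd : ∀ {x n m} → pow x n ≈ 1# → n ∣ m → pow x m ≈ 1#
  pow-dvd {x} {n} xⁿ≈1 (divides k ≡.refl) = begin
    pow x (k ℕ.* n) ≈⟨ pow-≡ x (ℕP.*-comm k n) ⟩
    pow x (n ℕ.* k) ≈⟨ pow-* x n k ⟩
    pow (pow x n) k ≈⟨ pow-cong k xⁿ≈1 ⟩
    pow 1# k        ≈⟨ pow-1# k ⟩
    1#              ∎

  *-cancelˡ-nonzero : ∀ {a b c} → ¬ a ≈ 0# → a * b ≈ a * c → b ≈ c
  *-cancelˡ-nonzero {a} {b} {c} a≉0 ab≈ac with inverse a a≉0
  ... | a⁻¹ , aa⁻¹≈1 = begin
    b             ≈⟨ *-identityˡ b ⟨
    1# * b        ≈⟨ *-congʳ a⁻¹a≈1 ⟨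
    (a⁻¹ * a) * b ≈⟨ *-assoc a⁻¹ a b ⟩
    a⁻¹ * (a * b) ≈⟨ *-congˡ ab≈ac ⟩
    a⁻¹ * (a * c) ≈⟨ *-assoc a⁻¹ a c ⟨
    (a⁻¹ * a) * c ≈⟨ *-congʳ a⁻¹a≈1 ⟩
    1# * c        ≈⟨ *-identityˡ c ⟩
    c             ∎
    where
    a⁻¹a≈1 : a⁻¹ * a ≈ 1#
    a⁻¹a≈1 = trans (*-comm a⁻¹ a) aa⁻¹≈1

  1≉0 : ¬ 1# ≈ 0#
  1≉0 = 0≉1 ∘ sym

  *-nonzero : ∀ {x y} → ¬ x ≈ 0# → ¬ y ≈ 0# → ¬ x * y ≈ 0#
  *-nonzero x≉0 y≉0 xy≈0 = y≉0 (*-cancelˡ-nonzero x≉0 (trans xy≈0 (sym (zeroʳ _))))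

  pow-nonzero : ∀ {x} → ¬ x ≈ 0# → ∀ k → ¬ pow x k ≈ 0#
  pow-nonzero x≉0 zero = 1≉0
  pow-nonzero x≉0 (suc k) = *-nonzero x≉0 (pow-nonzero x≉0 k)

  pow-of-zero : ∀ {x} m → .{{NonZero m}} → x ≈ 0# → pow x m ≈ 0#
  pow-of-zero (suc m) x≈0 = trans (*-congʳ x≈0) (zeroˡ _)

  square-roots : ∀ {z w} → z * z ≈ w * w → ¬ z ≈ w → z ≈ - w
  square-roots {z} {w} zz≈ww z≉w =
    inverseˡ-unique z w (*-cancelˡ-nonzero z-w≉0 (trans difference-of-squares (sym (zeroʳ _))))
    where
    z-w≉0 : ¬ z - w ≈ 0#
    z-w≉0 = z≉w ∘ x∙y⁻¹≈ε⇒x≈y z w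
    difference-of-squares : (z - w) * (z + w) ≈ 0#
    difference-of-squares = begin
      (z - w) * (z + w)                 ≈⟨ [y-z]x≈yx-zx (z + w) z w ⟩
      z * (z + w) - w * (z + w)         ≈⟨ +-cong (distribˡ z z w) (-‿cong (distribˡ w z w)) ⟩
      (z * z + z * w) - (w * z + w * w) ≈⟨ +-cong (+-congʳ zz≈ww) (-‿cong (+-congʳ (*-comm w z))) ⟩
      (w * w + z * w) - (z * w + w * w) ≈⟨ +-congʳ (+-comm (w * w) (z * w)) ⟩
      (z * w + w * w) - (z * w + w * w) ≈⟨ -‿inverseʳ _ ⟩
      0#                                ∎

  square-root-of-one : ∀ {x} → x * x ≈ 1# → ¬ x ≈ 1# → x ≈ - 1#
  square-root-of-one xx≈1 = square-roots (trans xx≈1 (sym (*-identityˡ 1#)))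

  square-root-of-one-nonzero : ∀ {x} → x * x ≈ 1# → ¬ x ≈ 0#
  square-root-of-one-nonzero {x} xx≈1 x≈0 = 1≉0 (trans (sym xx≈1) (trans (*-congʳ x≈0) (zeroˡ x)))

  -1≉0 : ¬ - 1# ≈ 0#
  -1≉0 -1≈0 = 1≉0 (begin
    1#       ≈⟨ ⁻¹-involutive 1# ⟨
    - (- 1#) ≈⟨ -‿cong -1≈0 ⟩
    - 0#     ≈⟨ ε⁻¹≈ε ⟩
    0#       ∎)

  -1*-1≈1 : - 1# * - 1# ≈ 1#
  -1*-1≈1 = trans (-1*x≈-x (- 1#)) (⁻¹-involutive 1#)

  pow-minus-one-odd : ∀ k → pow (- 1#) (suc (2 ℕ.* k)) ≈ - 1#
  pow-minus-one-odd k = begin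
    - 1# * pow (- 1#) (2 ℕ.* k)    ≈⟨ *-congˡ (pow-* (- 1#) 2 k) ⟩
    - 1# * pow (pow (- 1#) 2) k    ≈⟨ *-congˡ (pow-cong k (trans (*-congˡ (*-identityʳ _)) -1*-1≈1)) ⟩
    - 1# * pow 1# k                ≈⟨ *-congˡ (pow-1# k) ⟩
    - 1# * 1#                      ≈⟨ *-identityʳ _ ⟩
    - 1#                           ∎

  charZero⇒1≉-1 : CharZero F → ¬ 1# ≈ - 1#
  charZero⇒1≉-1 char0 1≈-1 = char0 1 (begin
    1# + (1# + 0#) ≈⟨ +-congˡ (+-identityʳ 1#) ⟩
    1# + 1#        ≈⟨ +-congˡ 1≈-1 ⟩
    1# - 1#        ≈⟨ -‿inverseʳ 1# ⟩
    0#             ∎)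

  order-of-root-of-minus-one : ¬ - 1# ≈ 1# → ∀ c {y} → pow y (2 ℕ.^ c) ≈ - 1# →
                               ∀ m → pow y m ≈ 1# → 2 ℕ.^ suc c ∣ m
  order-of-root-of-minus-one -1≉1 c {y} y^2^c≈-1 m yᵐ≈1 with Arithmetic.parity m
  ... | k , inj₂ ≡.refl = contradiction (begin
    - 1#                    ≈⟨ pow-minus-one-odd k ⟨
    pow (- 1#) m            ≈⟨ pow-cong m y^2^c≈-1 ⟨
    pow (pow y (2 ℕ.^ c)) m ≈⟨ pow-* y (2 ℕ.^ c) m ⟨
    pow y (2 ℕ.^ c ℕ.* m)   ≈⟨ pow-≡ y (ℕP.*-comm (2 ℕ.^ c) m) ⟩
    pow y (m ℕ.* 2 ℕ.^ c)   ≈⟨ pow-* y m (2 ℕ.^ c) ⟩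
    pow (pow y m) (2 ℕ.^ c) ≈⟨ pow-cong (2 ℕ.^ c) yᵐ≈1 ⟩
    pow 1# (2 ℕ.^ c)        ≈⟨ pow-1# (2 ℕ.^ c) ⟩
    1#                      ∎) -1≉1
  order-of-root-of-minus-one -1≉1 zero y^2^c≈-1 m yᵐ≈1 | k , inj₁ ≡.refl = divides k (ℕP.*-comm 2 k)
  order-of-root-of-minus-one -1≉1 (suc c) {y} y^2^c≈-1 m yᵐ≈1 | k , inj₁ ≡.refl =
    *-monoʳ-∣ 2 (order-of-root-of-minus-one -1≉1 c {pow y 2}
      (trans (sym (pow-* y 2 (2 ℕ.^ c))) y^2^c≈-1) k (trans (sym (pow-* y 2 k)) yᵐ≈1))

  evalMonic-X^m+1 : ∀ m x → evalMonic (1# ∷ replicate m 0#) x ≈ 1# + pow x (suc m)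
  evalMonic-X^m+1 m x = +-congˡ (*-congˡ (zeros m))
    where
    zeros : ∀ m → evalMonic (replicate m 0#) x ≈ pow x m
    zeros zero = refl
    zeros (suc m) = trans (+-identityˡ _) (*-congˡ (zeros m))

  root-of-minus-one : AlgClosed F → ∀ m → .{{NonZero m}} → ∃[ ξ ] (pow ξ m ≈ - 1#)
  root-of-minus-one closed m with closed (1# ∷ replicate (ℕ.pred m) 0#) (λ ())
  ... | ξ , root = ξ , (begin
    pow ξ m               ≈⟨ pow-≡ ξ (ℕP.suc-pred m) ⟨
    pow ξ (suc (ℕ.pred m)) ≈⟨ inverseʳ-unique 1# _ (trans (sym (evalMonic-X^m+1 (ℕ.pred m) ξ)) root) ⟩
    - 1#                  ∎)

module Characters {c ℓ c′ ℓ′} {F : Field c ℓ} {K : Field c′ ℓ′} (χ : UnitHom F K) where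
  private
    module F = Field F
    module K = Field K
    module PF = FieldPowers F
    module PK = FieldPowers K
  open import Relation.Binary.Reasoning.Setoid K.setoid

  -- χ(1) is a nonzero idempotent, hence 1
  map-1# : K._≈_ (map χ F.1#) K.1#
  map-1# = PK.*-cancelˡ-nonzero (map-unit χ F.1# PF.1≉0) (begin
    map χ F.1# K.* map χ F.1# ≈⟨ map-hom χ F.1# F.1# PF.1≉0 PF.1≉0 ⟨
    map χ (F.1# F.* F.1#)     ≈⟨ map-cong χ (PF.*-nonzero PF.1≉0 PF.1≉0) (F.*-identityˡ F.1#) ⟩
    map χ F.1#                ≈⟨ K.*-identityʳ _ ⟨
    map χ F.1# K.* K.1#       ∎)

  map-pow : ∀ {x} → ¬ F._≈_ x F.0# → ∀ k → K._≈_ (map χ (F.pow x k)) (K.pow (map χ x) k)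
  map-pow x≉0 zero = map-1#
  map-pow {x} x≉0 (suc k) =
    K.trans (map-hom χ x (F.pow x k) x≉0 (PF.pow-nonzero x≉0 k)) (K.*-congˡ (map-pow x≉0 k))

module FiniteField {c ℓ} (F : Field c ℓ) {q} (card : HasCardinality F q) where
  open Field F
  open FieldPowers F
  open import Data.Nat.Divisibility using (∣-trans; m∣m*n; m≤n⇒m!∣n!)

  private
    enum : Fin q → Carrier
    enum = proj₁ card
    enum-injective : ∀ i j → enum i ≈ enum j → i ≡ j
    enum-injective = proj₁ (proj₂ card)
    enum-surjective : ∀ x → ∃[ i ] (enum i ≈ x)
    enum-surjective = proj₂ (proj₂ card)
    position : Carrier → Fin q
    position x = proj₁ (enum-surjective x)
    enum-position : ∀ x → enum (position x) ≈ x
    enum-position x = proj₂ (enum-surjective x)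

  _≟_ : ∀ x y → Dec (x ≈ y)
  x ≟ y = map′ (λ i≡j → trans (sym (enum-position x)) (trans (reflexive (≡.cong enum i≡j)) (enum-position y)))
               (λ x≈y → enum-injective _ _ (trans (enum-position x) (trans x≈y (sym (enum-position y)))))
               (position x Fin.≟ position y)

  module _ {p} {P : Carrier → Set p} (P-resp : P Respects _≈_) (P? : ∀ x → Dec (P x)) where

    from-enumeration : (∀ i → P (enum i)) → ∀ x → P x
    from-enumeration all-i x = P-resp (enum-position x) (all-i (position x))

    all? : Dec (∀ x → P x)
    all? = map′ from-enumeration (λ all-x i → all-x (enum i)) (FinP.all? (P? ∘ enum))

    counterexample : ¬ (∀ x → P x) → ∃[ x ] (¬ P x)
    counterexample ¬all with FinP.¬∀⟶∃¬ q (P ∘ enum) (P? ∘ enum) (¬all ∘ from-enumeration)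
    ... | i , ¬Pi = enum i , ¬Pi

  -- pigeonhole on x^0, …, x^q: some exponent 0 < m ≤ q has x^m = 1
  small-order : ∀ x → ¬ x ≈ 0# → ∃[ m ] (0 < m × m ≤ q × pow x m ≈ 1#)
  small-order x x≉0 with FinP.pigeonhole (ℕP.n<1+n q) (λ (i : Fin (suc q)) → position (pow x (toℕ i)))
  ... | i , j , i<j , same-index = m , ℕP.m<n⇒0<n∸m i<j , m≤q ,
        *-cancelˡ-nonzero (pow-nonzero x≉0 (toℕ i)) (begin
          pow x (toℕ i) * pow x m      ≈⟨ pow-+ x (toℕ i) m ⟨
          pow x (toℕ i ℕ.+ m)          ≈⟨ pow-≡ x (ℕP.m+[n∸m]≡n (ℕP.<⇒≤ i<j)) ⟩
          pow x (toℕ j)                ≈⟨ enum-position _ ⟨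
          enum (position (pow x (toℕ j))) ≈⟨ reflexive (≡.cong enum same-index) ⟨
          enum (position (pow x (toℕ i))) ≈⟨ enum-position _ ⟩
          pow x (toℕ i)                ≈⟨ *-identityʳ _ ⟨
          pow x (toℕ i) * 1#           ∎)
    where
    open import Relation.Binary.Reasoning.Setoid setoid
    m : ℕ
    m = toℕ j ℕ.∸ toℕ i
    m≤q : m ≤ q
    m≤q = ℕP.≤-trans (ℕP.m∸n≤m (toℕ j) (toℕ i)) (ℕP.≤-pred (FinP.toℕ<n j))

  pow-factorial : ∀ x → ¬ x ≈ 0# → pow x (q !) ≈ 1#
  pow-factorial x x≉0 with small-order x x≉0
  ... | suc m , _ , m+1≤q , xᵐ⁺¹≈1 = pow-dvd xᵐ⁺¹≈1 (∣-trans (m∣m*n {suc m} (m !)) (m≤n⇒m!∣n! m+1≤q))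

module PowerTransfer {c ℓ c′ ℓ′} {F : Field c ℓ} {K : Field c′ ℓ′} where
  private
    module F = Field F
    module K = Field K
    module PF = FieldPowers F
    module PK = FieldPowers K

  -- x^i = x^(i+m) forces x^m = 1, hence ξ^m = 1 and ξ^(i+m) = ξ^i
  transfer-upward : ∀ {x ξ} → ¬ F._≈_ x F.0# → (∀ m → F._≈_ (F.pow x m) F.1# → K._≈_ (K.pow ξ m) K.1#) →
                    ∀ i m → F._≈_ (F.pow x i) (F.pow x (i ℕ.+ m)) → K._≈_ (K.pow ξ i) (K.pow ξ (i ℕ.+ m))
  transfer-upward {x} {ξ} x≉0 kills i m xⁱ≈xⁱ⁺ᵐ = begin
    K.pow ξ i                   ≈⟨ K.*-identityʳ _ ⟨
    K.pow ξ i K.* K.1#          ≈⟨ K.*-congˡ (kills m xᵐ≈1) ⟨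
    K.pow ξ i K.* K.pow ξ m     ≈⟨ PK.pow-+ ξ i m ⟨
    K.pow ξ (i ℕ.+ m)           ∎
    where
    open import Relation.Binary.Reasoning.Setoid K.setoid
    xᵐ≈1 : F._≈_ (F.pow x m) F.1#
    xᵐ≈1 = PF.*-cancelˡ-nonzero (PF.pow-nonzero x≉0 i)
             (F.trans (F.sym (PF.pow-+ x i m)) (F.trans (F.sym xⁱ≈xⁱ⁺ᵐ) (F.sym (F.*-identityʳ _))))

  transfer-powers : ∀ {x ξ} → ¬ F._≈_ x F.0# → (∀ m → F._≈_ (F.pow x m) F.1# → K._≈_ (K.pow ξ m) K.1#) →
                    ∀ i j → F._≈_ (F.pow x i) (F.pow x j) → K._≈_ (K.pow ξ i) (K.pow ξ j)
  transfer-powers x≉0 kills i j xⁱ≈xʲ with ℕP.≤-total i j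
  ... | inj₁ i≤j with ℕP.m≤n⇒∃[o]m+o≡n i≤j
  ...   | m , ≡.refl = transfer-upward x≉0 kills i m xⁱ≈xʲ
  transfer-powers x≉0 kills i j xⁱ≈xʲ | inj₂ j≤i with ℕP.m≤n⇒∃[o]m+o≡n j≤i
  ...   | m , ≡.refl = K.sym (transfer-upward x≉0 kills j m (F.sym xⁱ≈xʲ))

-- Over a finite field F in which -1 ≠ 1 and an algebraically closed field K there is a
-- character χ : F^× → K^× with χ(-1) = -1.  Write q! = 2^a·u with u odd; every unit x
-- has x^(q!) = 1, so the elements x^u form the 2-primary part of F^×.  Let b be least
-- with (x^u)^(2^(b+1)) = 1 for all units x, and g = x₀^u with g^(2^b) ≠ 1, so g^(2^b) = -1.
-- Because squares determine elements up to sign, ⟨g⟩ is the whole 2-primary part and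
-- x^u = g^(index x); with ξ ∈ K a root of X^(2^b) + 1 we put χ(x) = ξ^(index x).
module TwoPrimaryCharacter {c ℓ c′ ℓ′} (F : Field c ℓ) (K : Field c′ ℓ′) {q} (card : HasCardinality F q)
    (-1≉1 : ¬ Field._≈_ F (Field.-_ F (Field.1# F)) (Field.1# F)) (closed : AlgClosed K) where
  open Field F
  open FieldPowers F
  open FiniteField F card
  open PowerTransfer {F = F} {K = K}
  open import Data.Nat using (_^_)
  open import Algebra.Properties.Ring ring using (-1*x≈-x)
  open import Relation.Binary.Reasoning.Setoid setoid
  private
    module K = Field K
    module PK = FieldPowers K

  -- the existence proofs below are opaque so that the type checker never unfolds the searches
  opaque
    factorisation : Arithmetic.OddPart (q !)
    factorisation = Arithmetic.two-adic (q !) (ℕP.1≤n! q)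

  a v u : ℕ
  a = proj₁ factorisation
  v = proj₁ (proj₂ factorisation)
  u = suc (2 ℕ.* v)

  q!≡2^a*u : q ! ≡ 2 ^ a ℕ.* u
  q!≡2^a*u = proj₂ (proj₂ factorisation)

  pow-minus-one-u : pow (- 1#) u ≈ - 1#
  pow-minus-one-u = pow-minus-one-odd v

  TorsionAt : ℕ → Carrier → Set ℓ
  TorsionAt b x = ¬ x ≈ 0# → pow (pow x u) (2 ^ b) ≈ 1#

  Torsion : ℕ → Set (c ⊔ ℓ)
  Torsion b = ∀ x → TorsionAt b x

  torsionAt-resp : ∀ b → TorsionAt b Respects _≈_
  torsionAt-resp b x≈y torsion-x y≉0 =
    trans (pow-cong (2 ^ b) (pow-cong u (sym x≈y))) (torsion-x (y≉0 ∘ trans (sym x≈y)))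

  torsionAt? : ∀ b x → Dec (TorsionAt b x)
  torsionAt? b x = ¬? (x ≟ 0#) →-dec (pow (pow x u) (2 ^ b) ≟ 1#)

  torsion-a : Torsion a
  torsion-a x x≉0 = begin
    pow (pow x u) (2 ^ a) ≈⟨ pow-* x u (2 ^ a) ⟨
    pow x (u ℕ.* 2 ^ a)   ≈⟨ pow-≡ x (≡.trans (ℕP.*-comm u (2 ^ a)) (≡.sym q!≡2^a*u)) ⟩
    pow x (q !)           ≈⟨ pow-factorial x x≉0 ⟩
    1#                    ∎

  -- (-1)^u = -1 ≠ 1
  ¬torsion-0 : ¬ Torsion 0
  ¬torsion-0 torsion-0 = -1≉1 (begin
    - 1#                 ≈⟨ pow-minus-one-u ⟨
    pow (- 1#) u         ≈⟨ *-identityʳ _ ⟨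
    pow (pow (- 1#) u) 1 ≈⟨ torsion-0 (- 1#) -1≉0 ⟩
    1#                   ∎)

  opaque
    switch : ∃[ b ] (Torsion (suc b) × ¬ Torsion b)
    switch = Arithmetic.switch-point (λ b → all? (torsionAt-resp b) (torsionAt? b)) ¬torsion-0 a torsion-a

  b : ℕ
  b = proj₁ switch

  torsion-b+1 : Torsion (suc b)
  torsion-b+1 = proj₁ (proj₂ switch)

  opaque
    witness : ∃[ x ] (¬ TorsionAt b x)
    witness = counterexample (torsionAt-resp b) (torsionAt? b) (proj₂ (proj₂ switch))

  -- g = x₀^u generates the 2-primary part
  x₀ g : Carrier
  x₀ = proj₁ witness
  g = pow x₀ u

  x₀≉0 : ¬ x₀ ≈ 0#
  x₀≉0 x₀≈0 = proj₂ witness (contradiction x₀≈0)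

  g≉0 : ¬ g ≈ 0#
  g≉0 = pow-nonzero x₀≉0 u

  g^2^b≈-1 : pow g (2 ^ b) ≈ - 1#
  g^2^b≈-1 = square-root-of-one squared (λ g^2^b≈1 → proj₂ witness (λ _ → g^2^b≈1))
    where
    squared : pow g (2 ^ b) * pow g (2 ^ b) ≈ 1#
    squared = begin
      pow g (2 ^ b) * pow g (2 ^ b) ≈⟨ pow-+ g (2 ^ b) (2 ^ b) ⟨
      pow g (2 ^ b ℕ.+ 2 ^ b)       ≈⟨ pow-≡ g (≡.cong (2 ^ b ℕ.+_) (≡.sym (ℕP.+-identityʳ _))) ⟩
      pow g (2 ^ suc b)             ≈⟨ torsion-b+1 x₀ x₀≉0 ⟩
      1#                            ∎

  -- Induction on k: y² is a power of g^(2^(c+1)), i.e. y² = w² with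
  -- w a power of g^(2^c), so y = w or y = -w = g^(2^b) w.
  torsion-cyclic : ∀ k c → c ℕ.+ k ≡ suc b → ∀ y → pow y (2 ^ k) ≈ 1# → ∃[ j ] (y ≈ pow g (2 ^ c ℕ.* j))
  torsion-cyclic zero c _ y y¹≈1 = 0 , (begin
    y                  ≈⟨ *-identityʳ y ⟨
    pow y 1            ≈⟨ y¹≈1 ⟩
    pow g 0            ≈⟨ pow-≡ g (ℕP.*-zeroʳ (2 ^ c)) ⟨
    pow g (2 ^ c ℕ.* 0) ∎)
  torsion-cyclic (suc k) c c+k+1≡b+1 y y^2^k+1≈1
    with torsion-cyclic k (suc c) (≡.trans (≡.sym (ℕP.+-suc c k)) c+k+1≡b+1) (pow y 2)
           (trans (sym (pow-* y 2 (2 ^ k))) y^2^k+1≈1)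
  ... | j , y²≈ with y ≟ pow g (2 ^ c ℕ.* j)
  ...   | yes y≈w = j , y≈w
  ...   | no y≉w = 2 ^ k ℕ.+ j , (begin
    y                            ≈⟨ square-roots y*y≈w*w y≉w ⟩
    - w                          ≈⟨ -1*x≈-x w ⟨
    - 1# * w                     ≈⟨ *-congʳ g^2^b≈-1 ⟨
    pow g (2 ^ b) * w            ≈⟨ pow-+ g (2 ^ b) (2 ^ c ℕ.* j) ⟨
    pow g (2 ^ b ℕ.+ 2 ^ c ℕ.* j) ≈⟨ pow-≡ g exponent ⟩
    pow g (2 ^ c ℕ.* (2 ^ k ℕ.+ j)) ∎)
    where
    w : Carrier
    w = pow g (2 ^ c ℕ.* j)
    y*y≈w*w : y * y ≈ w * w
    y*y≈w*w = begin
      y * y                         ≈⟨ *-congˡ (*-identityʳ y) ⟨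
      pow y 2                       ≈⟨ y²≈ ⟩
      pow g (2 ^ suc c ℕ.* j)       ≈⟨ pow-≡ g (ℕP.*-assoc 2 (2 ^ c) j) ⟩
      pow g (2 ℕ.* (2 ^ c ℕ.* j))   ≈⟨ pow-≡ g (≡.cong (2 ^ c ℕ.* j ℕ.+_) (ℕP.+-identityʳ _)) ⟩
      pow g (2 ^ c ℕ.* j ℕ.+ 2 ^ c ℕ.* j) ≈⟨ pow-+ g (2 ^ c ℕ.* j) (2 ^ c ℕ.* j) ⟩
      w * w                         ∎
    exponent : 2 ^ b ℕ.+ 2 ^ c ℕ.* j ≡ 2 ^ c ℕ.* (2 ^ k ℕ.+ j)
    exponent = ≡.trans (≡.cong (λ e → 2 ^ e ℕ.+ 2 ^ c ℕ.* j) b≡c+k)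
               (≡.trans (≡.cong (ℕ._+ 2 ^ c ℕ.* j) (ℕP.^-distribˡ-+-* 2 c k))
                        (≡.sym (ℕP.*-distribˡ-+ (2 ^ c) (2 ^ k) j)))
      where
      b≡c+k : b ≡ c ℕ.+ k
      b≡c+k = ℕP.suc-injective (≡.trans (≡.sym c+k+1≡b+1) (ℕP.+-suc c k))

  private
    logarithm : ∀ x → ¬ x ≈ 0# → ∃[ j ] (pow x u ≈ pow g (2 ^ 0 ℕ.* j))
    logarithm x x≉0 = torsion-cyclic (suc b) 0 ≡.refl (pow x u) (torsion-b+1 x x≉0)

  -- the discrete logarithm of x^u to the base g
  index : Carrier → ℕ
  index x with x ≟ 0#
  ... | yes _ = 0
  ... | no x≉0 = proj₁ (logarithm x x≉0)

  index-spec : ∀ x → ¬ x ≈ 0# → pow x u ≈ pow g (index x)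
  index-spec x x≉0 with x ≟ 0#
  ... | yes x≈0 = contradiction x≈0 x≉0
  ... | no x≉0′ = trans (proj₂ (logarithm x x≉0′)) (pow-≡ g (ℕP.*-identityˡ (proj₁ (logarithm x x≉0′))))

  index-cong : ∀ {x y} → ¬ x ≈ 0# → x ≈ y → pow g (index x) ≈ pow g (index y)
  index-cong {x} {y} x≉0 x≈y =
    trans (sym (index-spec x x≉0)) (trans (pow-cong u x≈y) (index-spec y (x≉0 ∘ trans x≈y)))

  index-hom : ∀ {x y} → ¬ x ≈ 0# → ¬ y ≈ 0# → pow g (index (x * y)) ≈ pow g (index x ℕ.+ index y)
  index-hom {x} {y} x≉0 y≉0 = begin
    pow g (index (x * y))           ≈⟨ index-spec (x * y) (*-nonzero x≉0 y≉0) ⟨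
    pow (x * y) u                   ≈⟨ pow-distrib x y u ⟩
    pow x u * pow y u               ≈⟨ *-cong (index-spec x x≉0) (index-spec y y≉0) ⟩
    pow g (index x) * pow g (index y) ≈⟨ pow-+ g (index x) (index y) ⟨
    pow g (index x ℕ.+ index y)     ∎

  index-minus-one : pow g (index (- 1#)) ≈ pow g (2 ^ b)
  index-minus-one = begin
    pow g (index (- 1#)) ≈⟨ index-spec (- 1#) -1≉0 ⟨
    pow (- 1#) u         ≈⟨ pow-minus-one-u ⟩
    - 1#                 ≈⟨ g^2^b≈-1 ⟨
    pow g (2 ^ b)        ∎

  opaque
    root : ∃[ ξ ] K._≈_ (K.pow ξ (2 ^ b)) (K.- K.1#)
    root = PK.root-of-minus-one closed (2 ^ b) {{ℕP.m^n≢0 2 b}}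

  -- ξ, a root of X^(2^b) + 1, has the same order 2^(b+1) as g
  ξ : K.Carrier
  ξ = proj₁ root

  ξ^2^b≈-1 : K._≈_ (K.pow ξ (2 ^ b)) (K.- K.1#)
  ξ^2^b≈-1 = proj₂ root

  ξ≉0 : ¬ K._≈_ ξ K.0#
  ξ≉0 ξ≈0 = PK.-1≉0 (K.trans (K.sym ξ^2^b≈-1) (PK.pow-of-zero (2 ^ b) {{ℕP.m^n≢0 2 b}} ξ≈0))

  g-kills-ξ : ∀ m → pow g m ≈ 1# → K._≈_ (K.pow ξ m) K.1#
  g-kills-ξ m gᵐ≈1 = PK.pow-dvd ξ^2^b+1≈1 (order-of-root-of-minus-one -1≉1 b g^2^b≈-1 m gᵐ≈1)
    where
    ξ^2^b+1≈1 : K._≈_ (K.pow ξ (2 ^ suc b)) K.1#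
    ξ^2^b+1≈1 = K.trans (PK.pow-≡ ξ (ℕP.*-comm 2 (2 ^ b)))
                (K.trans (PK.pow-* ξ (2 ^ b) 2)
                (K.trans (PK.pow-cong 2 ξ^2^b≈-1)
                (K.trans (K.*-congˡ (K.*-identityʳ _)) PK.-1*-1≈1)))

  ξ-powers : ∀ i j → pow g i ≈ pow g j → K._≈_ (K.pow ξ i) (K.pow ξ j)
  ξ-powers = transfer-powers g≉0 g-kills-ξ

  χ : UnitHom F K
  χ = record
    { map = λ x → K.pow ξ (index x)
    ; map-cong = λ {x} {y} x≉0 x≈y → ξ-powers (index x) (index y) (index-cong x≉0 x≈y)
    ; map-unit = λ x _ → PK.pow-nonzero ξ≉0 (index x)
    ; map-hom = λ x y x≉0 y≉0 → K.trans (ξ-powers (index (x * y)) (index x ℕ.+ index y) (index-hom x≉0 y≉0)) (PK.pow-+ ξ (index x) (index y))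
    }

  χ-minus-one : K._≈_ (map χ (- 1#)) (K.- K.1#)
  χ-minus-one = K.trans (ξ-powers (index (- 1#)) (2 ^ b) index-minus-one) ξ^2^b≈-1

module GeneratorSigns {c ℓ c′ ℓ′} {F : Field c ℓ} {K : Field c′ ℓ′} {q} (card : HasCardinality F q)
    (closed : AlgClosed K) (1≉-1 : ¬ Field._≈_ K (Field.1# K) (Field.-_ K (Field.1# K)))
    (δ : UnitHom F K) (generator : IsGenerator δ) where
  private
    module F = Field F
    module K = Field K
    module PF = FieldPowers F
    module PK = FieldPowers K
  open Characters δ
  open FiniteField F card using (_≟_)

  -- if -1 ≠ 1 in F then δ(-1) = -1: its square is δ(1) = 1, and it is not 1 since
  -- the character χ with χ(-1) = -1 is a power of δ
  generator-at-minus-one : ¬ F._≈_ (F.- F.1#) F.1# → K._≈_ (map δ (F.- F.1#)) (K.- K.1#)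
  generator-at-minus-one -1≉1 = PK.square-root-of-one squares-to-one δ[-1]≉1
    where
    open TwoPrimaryCharacter F K card -1≉1 closed using (χ; χ-minus-one)
    open import Relation.Binary.Reasoning.Setoid K.setoid

    squares-to-one : K._≈_ (map δ (F.- F.1#) K.* map δ (F.- F.1#)) K.1#
    squares-to-one = begin
      map δ (F.- F.1#) K.* map δ (F.- F.1#) ≈⟨ map-hom δ _ _ PF.-1≉0 PF.-1≉0 ⟨
      map δ (F.- F.1# F.* F.- F.1#)         ≈⟨ map-cong δ (PF.*-nonzero PF.-1≉0 PF.-1≉0) PF.-1*-1≈1 ⟩
      map δ F.1#                            ≈⟨ map-1# ⟩
      K.1#                                  ∎

    δ[-1]≉1 : ¬ K._≈_ (map δ (F.- F.1#)) K.1#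
    δ[-1]≉1 δ[-1]≈1 with generator χ
    ... | k , χ≈δᵏ = 1≉-1 (begin
      K.1#                     ≈⟨ PK.pow-1# k ⟨
      K.pow K.1# k             ≈⟨ PK.pow-cong k δ[-1]≈1 ⟨
      K.pow (map δ (F.- F.1#)) k ≈⟨ χ≈δᵏ (F.- F.1#) PF.-1≉0 ⟨
      map χ (F.- F.1#)         ≈⟨ χ-minus-one ⟩
      K.- K.1#                 ∎)

  generator-on-square-roots-of-one : ∀ {x} → F._≈_ (x F.* x) F.1# →
    K._≈_ (map δ x) K.1# ⊎ K._≈_ (map δ x) (K.- K.1#)
  generator-on-square-roots-of-one {x} xx≈1 with x ≟ F.1#
  ... | yes x≈1 = inj₁ (K.trans (map-cong δ (PF.square-root-of-one-nonzero xx≈1) x≈1) map-1#)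
  ... | no x≉1 = inj₂ (K.trans (map-cong δ (PF.square-root-of-one-nonzero xx≈1) x≈-1)
                               (generator-at-minus-one (x≉1 ∘ F.trans x≈-1)))
    where
    x≈-1 : F._≈_ x (F.- F.1#)
    x≈-1 = PF.square-root-of-one xx≈1 x≉1

-- the arithmetic operators of ℕ, in which the theorem is stated (they would clash with the
-- field operations opened in the modules above)
open import Data.Nat using (_+_; _*_; _∸_; _/_)

lemma6p1 : (F K : Field 0ℓ 0ℓ) → CharZero K → AlgClosed K →
    (n q : ℕ) → 1 ≤ n → IsPrimePower q → HasCardinality F q → n ∣ q ∸ 1 →
    (δ : UnitHom F K) → IsGenerator δ →
    (ζ : Field.Carrier F) → Field.HasOrder F ζ n →
    (d d̂ t t̂ : ℕ) → 0 < d → 0 < d̂ → .{{_ : NonZero t}} → 0 < t̂ →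
    t ∣ q ∸ 1 → d * t̂ ≡ d̂ * t →
    (λs : List ℕ) → All (0 <_) λs →
    let s = (q ∸ 1) / t
        y = Field.pow K (map δ ζ) (d * s * (t̂ C 2) * sum λs)
    in (Field._≈_ K y (Field.1# K) ⊎ Field._≈_ K y (Field.-_ K (Field.1# K)))
       × (((¬ (2 ∣ n) → n ∣ q ∸ 1) × (2 ∣ n → 2 * n ∣ q ∸ 1)) → Field._≈_ K y (Field.1# K))
lemma6p1 F K char0 closed n q _ _ card n∣q-1 δ generator ζ (ζ≉0 , ζⁿ≈1 , _) d d̂ t t̂ _ _ _ t∣q-1 dt̂≡d̂t λs _ =
  ω^E≈±1 , λ (_ , even-case) → PK.pow-dvd {m = E} ωⁿ≈1 (Arithmetic.divides-half (divides-2E n∣q-1) (divides-2E ∘ even-case))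
  where
  module F = Field F
  module K = Field K
  module PF = FieldPowers F
  module PK = FieldPowers K
  open Characters δ
  open GeneratorSigns card closed (PK.charZero⇒1≉-1 char0) δ generator

  s E : ℕ
  s = (q ∸ 1) / t
  E = d * s * (t̂ C 2) * sum λs

  divides-2E : ∀ {m} → m ∣ q ∸ 1 → m ∣ 2 * E
  divides-2E {m} m∣q-1 = ≡.subst (m ∣_) (≡.sym twice-E) (∣m⇒∣m*n _ (∣n⇒∣m*n d̂ m∣q-1))
    where
    twice-E : 2 * E ≡ d̂ * (q ∸ 1) * ((t̂ ∸ 1) * sum λs)
    twice-E = ≡.trans (Arithmetic.twice-exponent d d̂ t t̂ s (sum λs) dt̂≡d̂t)
                      (≡.cong (λ z → d̂ * z * ((t̂ ∸ 1) * sum λs)) (m/n*n≡m t∣q-1))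

  ζ^E-squared : F._≈_ (F.pow ζ E F.* F.pow ζ E) F.1#
  ζ^E-squared = F.trans (F.sym (PF.pow-+ ζ E E))
                (F.trans (PF.pow-≡ ζ (≡.cong (E +_) (≡.sym (ℕP.+-identityʳ E))))
                         (PF.pow-dvd ζⁿ≈1 (divides-2E n∣q-1)))

  ω^E≈δ[ζ^E] : K._≈_ (K.pow (map δ ζ) E) (map δ (F.pow ζ E))
  ω^E≈δ[ζ^E] = K.sym (map-pow ζ≉0 E)

  ω^E≈±1 : K._≈_ (K.pow (map δ ζ) E) K.1# ⊎ K._≈_ (K.pow (map δ ζ) E) (K.- K.1#)
  ω^E≈±1 = Sum.map (K.trans ω^E≈δ[ζ^E]) (K.trans ω^E≈δ[ζ^E]) (generator-on-square-roots-of-one ζ^E-squared)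

  ωⁿ≈1 : K._≈_ (K.pow (map δ ζ) n) K.1#
  ωⁿ≈1 = K.trans (K.sym (map-pow ζ≉0 n)) (K.trans (map-cong δ (PF.pow-nonzero ζ≉0 n) ζⁿ≈1) map-1#)
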